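{- In $\text{E-HA}^{\omega*}_{\mathrm{st}\lor}$, the principle $\mathsf{NU}$ implies $\neg \, \forall n:0 \, (n = 0 \lor \neg \, n = 0)$; that is, $\text{E-HA}^{\omega*}_{\mathrm{st}\lor} + \mathsf{NU} \vdash \neg \, \forall n:0 \, (n = 0 \lor \neg \, n = 0)$, where $\mathsf{NU}$ is the schema $\forall y: \tau\, \exists^{\mathrm{st}} x: \sigma \, \Phi(x,y) \to \exists^{\mathrm{st}} x: \sigma \, \forall y: \tau\, \Phi(x,y)$ for all types and all formulae $\Phi$.
   Context: $\text{E-HA}^{\omega*}$ is extensional Heyting arithmetic in all finite types over the types generated by $0$, $\sigma\to\tau$ and $\sigma^*$ (finite sequences), with constants for the empty sequence, prepending, a list recursor, and the axiom that every sequence is empty or a prepend. $\text{E-HA}^{\omega*}_{\mathrm{st}}$ adds predicates $\mathrm{st}_\sigma$ and external quantifiers $\forall^{\mathrm{st}}x\,\Phi :\leftrightarrow \forall x(\mathrm{st}(x)\to\Phi)$, $\exists^{\mathrm{st}}x\,\Phi :\leftrightarrow \exists x(\mathrm{st}(x)\land\Phi)$; internal formulae are those not containing $\mathrm{st}$. Axioms: those of $\text{E-HA}^{\omega*}$, $\mathrm{st}(x)\land x=y\to\mathrm{st}(y)$, $\mathrm{st}(a)$ for closed terms $a$, $\mathrm{st}(f)\land\mathrm{st}(x)\to\mathrm{st}(fx)$, and external induction $(\Phi(0)\land\forall^{\mathrm{st}}x:0(\Phi(x)\to\Phi(\mathrm{S}x)))\to\forall^{\mathrm{st}}x:0\,\Phi(x)$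 for all formulae. $\text{E-HA}^{\omega*}_{\mathrm{st}\lor}$ is $\text{E-HA}^{\omega*}_{\mathrm{st}}$ with the (internal) induction schema restricted to internal formulae not containing $\lor$. -}

module Defs where

open import Data.List using (List; []; _∷_; map)
open import Data.List.Membership.Propositional using (_∈_)

infixr 7 _⇒_
infixr 5 _⊃_
infixr 6 _∧_ _∨_
infix 8 _≐_
infix 9 _[_]
infix 2 _∣_⊢_ ⊢_

data Ty : Set where
  O   : Ty
  _⇒_ : Ty → Ty → Ty
  _*  : Ty → Ty

Ctx : Set
Ctx = List Ty

data Var : Ctx → Ty → Set where
  vz : ∀ {Γ σ} → Var (σ ∷ Γ) σ
  vs : ∀ {Γ σ τ} → Var Γ σ → Var (τ ∷ Γ) σ

data Const : Ty → Set where
  zero' : Const O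
  succ' : Const (O ⇒ O)
  Π     : (σ τ : Ty) → Const (σ ⇒ τ ⇒ σ)
  Σc    : (ρ σ τ : Ty) → Const ((ρ ⇒ σ ⇒ τ) ⇒ (ρ ⇒ σ) ⇒ ρ ⇒ τ)
  R     : (σ : Ty) → Const (O ⇒ σ ⇒ (σ ⇒ O ⇒ σ) ⇒ σ)
  nil   : (σ : Ty) → Const (σ *)
  cons  : (σ : Ty) → Const (σ ⇒ σ * ⇒ σ *)
  L     : (σ τ : Ty) → Const (τ ⇒ (σ ⇒ σ * ⇒ τ ⇒ τ) ⇒ σ * ⇒ τ)

data Tm (Γ : Ctx) : Ty → Set where
  var : ∀ {σ} → Var Γ σ → Tm Γ σ
  con : ∀ {σ} → Const σ → Tm Γ σ
  app : ∀ {σ τ} → Tm Γ (σ ⇒ τ) → Tm Γ σ → Tm Γ τ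

data Fm (Γ : Ctx) : Set where
  ⊥'   : Fm Γ
  _≐_  : ∀ {σ} → Tm Γ σ → Tm Γ σ → Fm Γ
  st   : ∀ {σ} → Tm Γ σ → Fm Γ
  _∧_  : Fm Γ → Fm Γ → Fm Γ
  _∨_  : Fm Γ → Fm Γ → Fm Γ
  _⊃_  : Fm Γ → Fm Γ → Fm Γ
  all  : (σ : Ty) → Fm (σ ∷ Γ) → Fm Γ
  ex   : (σ : Ty) → Fm (σ ∷ Γ) → Fm Γ

¬' : ∀ {Γ} → Fm Γ → Fm Γ
¬' φ = φ ⊃ ⊥'

Ren : Ctx → Ctx → Set
Ren Γ Δ = ∀ {σ} → Var Γ σ → Var Δ σ

liftR : ∀ {Γ Δ τ} → Ren Γ Δ → Ren (τ ∷ Γ) (τ ∷ Δ)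
liftR ρ vz     = vz
liftR ρ (vs x) = vs (ρ x)

renT : ∀ {Γ Δ σ} → Ren Γ Δ → Tm Γ σ → Tm Δ σ
renT ρ (var x)   = var (ρ x)
renT ρ (con c)   = con c
renT ρ (app t u) = app (renT ρ t) (renT ρ u)

renF : ∀ {Γ Δ} → Ren Γ Δ → Fm Γ → Fm Δ
renF ρ ⊥'        = ⊥'
renF ρ (a ≐ b)   = renT ρ a ≐ renT ρ b
renF ρ (st a)    = st (renT ρ a)
renF ρ (φ ∧ ψ)   = renF ρ φ ∧ renF ρ ψ
renF ρ (φ ∨ ψ)   = renF ρ φ ∨ renF ρ ψ
renF ρ (φ ⊃ ψ)   = renF ρ φ ⊃ renF ρ ψ
renF ρ (all σ φ) = all σ (renF (liftR ρ) φ)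
renF ρ (ex σ φ)  = ex σ (renF (liftR ρ) φ)

wkT : ∀ {Γ σ τ} → Tm Γ σ → Tm (τ ∷ Γ) σ
wkT = renT vs

wkF : ∀ {Γ τ} → Fm Γ → Fm (τ ∷ Γ)
wkF = renF vs

Sub : Ctx → Ctx → Set
Sub Γ Δ = ∀ {σ} → Var Γ σ → Tm Δ σ

liftS : ∀ {Γ Δ τ} → Sub Γ Δ → Sub (τ ∷ Γ) (τ ∷ Δ)
liftS s vz     = var vz
liftS s (vs x) = wkT (s x)

subT : ∀ {Γ Δ σ} → Sub Γ Δ → Tm Γ σ → Tm Δ σ
subT s (var x)   = s x
subT s (con c)   = con c
subT s (app t u) = app (subT s t) (subT s u)

subF : ∀ {Γ Δ} → Sub Γ Δ → Fm Γ → Fm Δ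
subF s ⊥'        = ⊥'
subF s (a ≐ b)   = subT s a ≐ subT s b
subF s (st a)    = st (subT s a)
subF s (φ ∧ ψ)   = subF s φ ∧ subF s ψ
subF s (φ ∨ ψ)   = subF s φ ∨ subF s ψ
subF s (φ ⊃ ψ)   = subF s φ ⊃ subF s ψ
subF s (all σ φ) = all σ (subF (liftS s) φ)
subF s (ex σ φ)  = ex σ (subF (liftS s) φ)

sub0 : ∀ {Γ σ} → Tm Γ σ → Sub (σ ∷ Γ) Γ
sub0 t vz     = t
sub0 t (vs x) = var x

_[_] : ∀ {Γ σ} → Fm (σ ∷ Γ) → Tm Γ σ → Fm Γ
φ [ t ] = subF (sub0 t) φ

subSucc : ∀ {Γ} → Sub (O ∷ Γ) (O ∷ Γ)
subSucc vz     = app (con succ') (var vz)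
subSucc (vs x) = var (vs x)

0̂ : ∀ {Γ} → Tm Γ O
0̂ = con zero'

1̂ : ∀ {Γ} → Tm Γ O
1̂ = app (con succ') 0̂

all-st : ∀ {Γ} (σ : Ty) → Fm (σ ∷ Γ) → Fm Γ
all-st σ φ = all σ (st (var vz) ⊃ φ)

ex-st : ∀ {Γ} (σ : Ty) → Fm (σ ∷ Γ) → Fm Γ
ex-st σ φ = ex σ (st (var vz) ∧ φ)

data Internal {Γ : Ctx} : Fm Γ → Set where
  i⊥  : Internal ⊥'
  i≐  : ∀ {σ} {a b : Tm Γ σ} → Internal (a ≐ b)
  i∧  : ∀ {φ ψ} → Internal φ → Internal ψ → Internal (φ ∧ ψ)
  i∨  : ∀ {φ ψ} → Internal φ → Internal ψ → Internal (φ ∨ ψ)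
  i⊃  : ∀ {φ ψ} → Internal φ → Internal ψ → Internal (φ ⊃ ψ)
  iall : ∀ {σ φ} → Internal {σ ∷ Γ} φ → Internal (all σ φ)
  iex  : ∀ {σ φ} → Internal {σ ∷ Γ} φ → Internal (ex σ φ)

data InternalNoOr {Γ : Ctx} : Fm Γ → Set where
  i⊥  : InternalNoOr ⊥'
  i≐  : ∀ {σ} {a b : Tm Γ σ} → InternalNoOr (a ≐ b)
  i∧  : ∀ {φ ψ} → InternalNoOr φ → InternalNoOr ψ → InternalNoOr (φ ∧ ψ)
  i⊃  : ∀ {φ ψ} → InternalNoOr φ → InternalNoOr ψ → InternalNoOr (φ ⊃ ψ)
  iall : ∀ {σ φ} → InternalNoOr {σ ∷ Γ} φ → InternalNoOr (all σ φ)
  iex  : ∀ {σ φ} → InternalNoOr {σ ∷ Γ} φ → InternalNoOr (ex σ φ)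

closed : ∀ {Γ σ} → Tm [] σ → Tm Γ σ
closed = renT (λ ())

swap : ∀ {Γ σ τ} → Ren (τ ∷ σ ∷ Γ) (σ ∷ τ ∷ Γ)
swap vz          = vs vz
swap (vs vz)     = vz
swap (vs (vs x)) = vs (vs x)

data Axiom (Γ : Ctx) : Fm Γ → Set where
  eq-refl : ∀ {σ} (a : Tm Γ σ) → Axiom Γ (a ≐ a)
  eq-leib : ∀ {σ} (φ : Fm (σ ∷ Γ)) → Internal φ → (a b : Tm Γ σ) →
            Axiom Γ (a ≐ b ⊃ φ [ a ] ⊃ φ [ b ])
  ext     : ∀ {σ τ} (f g : Tm Γ (σ ⇒ τ)) →
            Axiom Γ (all σ (app (wkT f) (var vz) ≐ app (wkT g) (var vz)) ⊃ f ≐ g)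
  succ-ne0 : (a : Tm Γ O) → Axiom Γ (¬' (app (con succ') a ≐ 0̂))
  succ-inj : (a b : Tm Γ O) → Axiom Γ (app (con succ') a ≐ app (con succ') b ⊃ a ≐ b)
  Π-eq : ∀ {σ τ} (a : Tm Γ σ) (b : Tm Γ τ) →
         Axiom Γ (app (app (con (Π σ τ)) a) b ≐ a)
  Σ-eq : ∀ {ρ σ τ} (a : Tm Γ (ρ ⇒ σ ⇒ τ)) (b : Tm Γ (ρ ⇒ σ)) (c : Tm Γ ρ) →
         Axiom Γ (app (app (app (con (Σc ρ σ τ)) a) b) c ≐ app (app a c) (app b c))
  R-0 : ∀ {σ} (y : Tm Γ σ) (z : Tm Γ (σ ⇒ O ⇒ σ)) →
        Axiom Γ (app (app (app (con (R σ)) 0̂) y) z ≐ y)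
  R-S : ∀ {σ} (x : Tm Γ O) (y : Tm Γ σ) (z : Tm Γ (σ ⇒ O ⇒ σ)) →
        Axiom Γ (app (app (app (con (R σ)) (app (con succ') x)) y) z
                 ≐ app (app z (app (app (app (con (R σ)) x) y) z)) x)
  L-nil  : ∀ {σ τ} (x : Tm Γ τ) (y : Tm Γ (σ ⇒ σ * ⇒ τ ⇒ τ)) →
           Axiom Γ (app (app (app (con (L σ τ)) x) y) (con (nil σ)) ≐ x)
  L-cons : ∀ {σ τ} (x : Tm Γ τ) (y : Tm Γ (σ ⇒ σ * ⇒ τ ⇒ τ)) (a : Tm Γ σ) (s : Tm Γ (σ *)) →
           Axiom Γ (app (app (app (con (L σ τ)) x) y) (app (app (con (cons σ)) a) s)
                    ≐ app (app (app y a) s) (app (app (app (con (L σ τ)) x) y) s))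
  seq-cases : ∀ {σ} (s : Tm Γ (σ *)) →
              Axiom Γ (s ≐ con (nil σ) ∨
                       ex σ (ex (σ *) (wkT (wkT s) ≐ app (app (con (cons σ)) (var (vs vz))) (var vz))))
  ind : (φ : Fm (O ∷ Γ)) → InternalNoOr φ →
        Axiom Γ ((φ [ 0̂ ] ∧ all O (φ ⊃ subF subSucc φ)) ⊃ all O φ)
  st-eq     : ∀ {σ} (x y : Tm Γ σ) → Axiom Γ ((st x ∧ x ≐ y) ⊃ st y)
  st-closed : ∀ {σ} (a : Tm [] σ) → Axiom Γ (st (closed a))
  st-app    : ∀ {σ τ} (f : Tm Γ (σ ⇒ τ)) (x : Tm Γ σ) → Axiom Γ ((st f ∧ st x) ⊃ st (app f x))
  ext-ind : (φ : Fm (O ∷ Γ)) →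
            Axiom Γ ((φ [ 0̂ ] ∧ all-st O (φ ⊃ subF subSucc φ)) ⊃ all-st O φ)
  -- NU: ∀y:τ ∃^st x:σ Φ(x,y) → ∃^st x:σ ∀y:τ Φ(x,y); Φ has x then y (y innermost)
  NU : (σ τ : Ty) (Φ : Fm (τ ∷ σ ∷ Γ)) →
       Axiom Γ (all τ (ex-st σ (renF swap Φ)) ⊃ ex-st σ (all τ Φ))

data _∣_⊢_ : (Γ : Ctx) → List (Fm Γ) → Fm Γ → Set where
  ax   : ∀ {Γ Δ φ} → Axiom Γ φ → Γ ∣ Δ ⊢ φ
  hyp  : ∀ {Γ Δ φ} → φ ∈ Δ → Γ ∣ Δ ⊢ φ
  ⊥E   : ∀ {Γ Δ φ} → Γ ∣ Δ ⊢ ⊥' → Γ ∣ Δ ⊢ φ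
  ∧I   : ∀ {Γ Δ φ ψ} → Γ ∣ Δ ⊢ φ → Γ ∣ Δ ⊢ ψ → Γ ∣ Δ ⊢ φ ∧ ψ
  ∧E₁  : ∀ {Γ Δ φ ψ} → Γ ∣ Δ ⊢ φ ∧ ψ → Γ ∣ Δ ⊢ φ
  ∧E₂  : ∀ {Γ Δ φ ψ} → Γ ∣ Δ ⊢ φ ∧ ψ → Γ ∣ Δ ⊢ ψ
  ∨I₁  : ∀ {Γ Δ φ ψ} → Γ ∣ Δ ⊢ φ → Γ ∣ Δ ⊢ φ ∨ ψ
  ∨I₂  : ∀ {Γ Δ φ ψ} → Γ ∣ Δ ⊢ ψ → Γ ∣ Δ ⊢ φ ∨ ψ
  ∨E   : ∀ {Γ Δ φ ψ χ} → Γ ∣ Δ ⊢ φ ∨ ψ → Γ ∣ φ ∷ Δ ⊢ χ → Γ ∣ ψ ∷ Δ ⊢ χ → Γ ∣ Δ ⊢ χ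
  ⊃I   : ∀ {Γ Δ φ ψ} → Γ ∣ φ ∷ Δ ⊢ ψ → Γ ∣ Δ ⊢ φ ⊃ ψ
  ⊃E   : ∀ {Γ Δ φ ψ} → Γ ∣ Δ ⊢ φ ⊃ ψ → Γ ∣ Δ ⊢ φ → Γ ∣ Δ ⊢ ψ
  ∀I   : ∀ {Γ Δ σ φ} → (σ ∷ Γ) ∣ map wkF Δ ⊢ φ → Γ ∣ Δ ⊢ all σ φ
  ∀E   : ∀ {Γ Δ σ φ} → Γ ∣ Δ ⊢ all σ φ → (t : Tm Γ σ) → Γ ∣ Δ ⊢ φ [ t ]
  ∃I   : ∀ {Γ Δ σ φ} (t : Tm Γ σ) → Γ ∣ Δ ⊢ φ [ t ] → Γ ∣ Δ ⊢ ex σ φ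
  ∃E   : ∀ {Γ Δ σ φ ψ} → Γ ∣ Δ ⊢ ex σ φ → (σ ∷ Γ) ∣ φ ∷ map wkF Δ ⊢ wkF ψ → Γ ∣ Δ ⊢ ψ

⊢_ : Fm [] → Set
⊢ φ = [] ∣ [] ⊢ φ

module Submission where

-- Let Φ(x,y) say that x
-- is the value at y of the characteristic function of "y ≠ 0":
--     (y = 0 → x = 0) ∧ (¬ y = 0 → x = 1).
-- If every n satisfies n = 0 ∨ ¬ n = 0, then every y has a value x among the
-- standard closed terms 0, 1 (lemma pointwiseValue).  NU turns this pointwise
-- standard choice into one standard x with Φ(x,y) for all y; but instantiating
-- y := 0 and y := 1 gives x = 0 and x = 1, hence 1 = 0, contradicting the
-- successor axiom (lemma noUniformValue).

open import Defs
open import Data.List using ([]; _∷_)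
open import Data.List.Membership.Propositional using (_∈_)
open import Data.List.Membership.Propositional.Properties using (∈-map⁺)
open import Data.List.Relation.Unary.Any using (here; there)
open import Relation.Binary.PropositionalEquality using (refl)

exStI : ∀ {Γ Δ σ} {φ : Fm (σ ∷ Γ)} (a : Tm [] σ) →
        Γ ∣ Δ ⊢ φ [ closed a ] → Γ ∣ Δ ⊢ ex-st σ φ
exStI a p = ∃I (closed a) (∧I (ax (st-closed a)) p)

rewriteEq : ∀ {Γ Δ σ} {a b : Tm Γ σ} {c : Const σ} →
            Γ ∣ Δ ⊢ a ≐ b → Γ ∣ Δ ⊢ a ≐ con c → Γ ∣ Δ ⊢ b ≐ con c
rewriteEq {a = a} {b} {c} a≐b a≐c =
  ⊃E (⊃E (ax (eq-leib (var vz ≐ con c) i≐ a b)) a≐b) a≐c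

decidableZero : ∀ {Γ} → Fm Γ
decidableZero = all O (var vz ≐ 0̂ ∨ ¬' (var vz ≐ 0̂))

-- Φ(x,y) with x the outer and y the inner variable: x is 0 when y = 0 and
-- 1 when y ≠ 0.
indicator : ∀ {Γ} → Fm (O ∷ O ∷ Γ)
indicator = (var vz ≐ 0̂ ⊃ var (vs vz) ≐ 0̂) ∧ (¬' (var vz ≐ 0̂) ⊃ var (vs vz) ≐ 1̂)

-- Under decidability of "n = 0", every y has a standard value x: take 0 if
-- y = 0 and 1 otherwise.  This is the premise of NU for Φ = indicator.
pointwiseValue : ∀ {Γ Δ} → decidableZero ∈ Δ →
                 Γ ∣ Δ ⊢ all O (ex-st O (renF swap indicator))
pointwiseValue dec =
  ∀I (∨E (∀E (hyp (∈-map⁺ wkF dec)) (var vz))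
         (exStI 0̂ (∧I (⊃I (ax (eq-refl 0̂)))
                      (⊃I (⊥E (⊃E (hyp (here refl)) (hyp (there (here refl))))))))
         (exStI 1̂ (∧I (⊃I (⊥E (⊃E (hyp (there (here refl))) (hyp (here refl)))))
                      (⊃I (ax (eq-refl 1̂))))))

-- No single x satisfies Φ(x,y) for all y: y := 0 forces x = 0, y := 1
-- forces x = 1 (as 1 ≠ 0), and then 1 = 0 contradicts the successor axiom.
noUniformValue : ∀ {Γ Δ} → (O ∷ Γ) ∣ Δ ⊢ all O indicator → (O ∷ Γ) ∣ Δ ⊢ ⊥'
noUniformValue {Γ} {Δ} uniform = ⊃E (ax (succ-ne0 0̂)) (rewriteEq x≐1 x≐0)
  where
  x≐0 : (O ∷ Γ) ∣ Δ ⊢ var vz ≐ 0̂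
  x≐0 = ⊃E (∧E₁ (∀E uniform 0̂)) (ax (eq-refl 0̂))
  x≐1 : (O ∷ Γ) ∣ Δ ⊢ var vz ≐ 1̂
  x≐1 = ⊃E (∧E₂ (∀E uniform 1̂)) (ax (succ-ne0 0̂))

mainTheorem12 : ⊢ ¬' (all O (var vz ≐ 0̂ ∨ ¬' (var vz ≐ 0̂)))
mainTheorem12 =
  ⊃I (∃E (⊃E (ax (NU O O indicator)) (pointwiseValue (here refl)))
         (noUniformValue (∧E₂ (hyp (here refl)))))
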